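{- Let $0<\lambda\le1$ be a rational number and let $\{x_n\}_{n=1}^\infty$ be the infinite greedy Egyptian underapproximation of $\lambda$. Then there exists a positive integer $N$ such that $x_{n+1}=x_n^2-x_n+1$ for all $n\ge N$.
   Context: The infinite greedy Egyptian underapproximation of $0<\lambda\le1$ is the sequence of positive integers defined recursively by $x_i=\big\lfloor(\lambda-\sum_{j=1}^{i-1}1/x_j)^{ -1}\big\rfloor+1$ for all $i\ge1$ (empty sum $=0$). -}

module Defs where

open import Data.Nat using (ℕ; zero; suc)
open import Data.Integer using (+_; +[1+_]; ∣_∣)
open import Data.Rational using (ℚ; mkℚ; 1/_; floor; _-_; _/_; 0ℚ)

-- Greedy choice for a remainder r > 0:  ⌊ 1 / r ⌋ + 1.
-- (The fallback value 1 for r ≤ 0 is never reached for 0 < λ, since the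
--  remainders of the greedy underapproximation stay strictly positive.)
greedyStep : ℚ → ℕ
greedyStep r@(mkℚ +[1+ n ] d _) = suc ∣ floor (1/ r) ∣
greedyStep _ = 1

-- unit fraction 1 / x (x is always positive here; 0 ↦ 0 is a dummy case)
unitFrac : ℕ → ℚ
unitFrac zero = 0ℚ
unitFrac (suc k) = + 1 / suc k

mutual
  greedyRem : ℚ → ℕ → ℚ
  greedyRem λ' zero = λ'
  greedyRem λ' (suc i) = greedyRem λ' i - unitFrac (egyptian λ' i)

  -- egyptian λ i  is the paper's  x_{i+1}  (0-indexed sequence)
  egyptian : ℚ → ℕ → ℕ
  egyptian λ' i = greedyStep (greedyRem λ' i)

-- Write the current remainder in lowest terms as a/b. The greedy term x = ⌊b/a⌋ + 1 leaves
-- a/b − 1/x = (a − b mod a)/(b x), and coprimality forces b mod a ≠ 0 when a > 1, so the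
-- numerator of the reduced remainder strictly decreases until it becomes 1. From a remainder
-- 1/b on, the greedy term is x = b + 1 and the next remainder is 1/(b x), whose greedy term is
-- b x + 1 = x² − x + 1.
module Submission where

open import Data.Nat using (ℕ; suc; _≤_; _*_; _∸_; _+_)
open import Data.Rational using (ℚ; 0ℚ; 1ℚ) renaming (_<_ to _<ℚ_; _≤_ to _≤ℚ_)
open import Data.Product using (∃)
open import Relation.Binary.PropositionalEquality using (_≡_)
open import Defs

open import Data.Nat using (zero; z≤n; s≤s; s≤s⁻¹; >-nonZero; _<_; NonZero; _≤′_; ≤′-refl; ≤′-step)
open import Data.Nat.Properties
open import Data.Nat.DivMod using (_/_; _%_; m≡m%n+[m/n]*n; m%n<n; n%1≡0; n/1≡n)
open import Data.Nat.Divisibility using (m%n≡0⇒n∣m; ∣-refl)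
open import Data.Nat.Coprimality using (Coprime; 1-coprimeTo; coprime?)
import Data.Integer as ℤ
import Data.Integer.Properties as ℤ
open import Data.Integer using (+_; +[1+_]; -[1+_])
open import Data.Rational using (mkℚ; ↥_; normalize; _-_; *<*) renaming (_/_ to _/ℚ_)
open import Data.Rational.Properties using (normalize-coprime; normalize-cong; ↥-normalize)
open import Data.Product using (_,_; _×_; proj₁; proj₂; map₂)
open import Data.Empty using (⊥-elim)
open import Relation.Binary.PropositionalEquality
  using (refl; sym; trans; cong; subst; module ≡-Reasoning)
open import Relation.Nullary.Decidable using (recompute)

m*[1+n/m]≡n+[m∸n%m] : ∀ m n .{{_ : NonZero m}} → m * suc (n / m) ≡ n + (m ∸ n % m)
m*[1+n/m]≡n+[m∸n%m] m n = begin
  m * suc (n / m)                      ≡⟨ *-suc m (n / m) ⟩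
  m + m * (n / m)                      ≡⟨ cong (_+_ m) (*-comm m (n / m)) ⟩
  m + n / m * m                        ≡⟨ cong (_+ n / m * m) (sym (m+[n∸m]≡n (<⇒≤ (m%n<n n m)))) ⟩
  n % m + (m ∸ n % m) + n / m * m      ≡⟨ +-assoc (n % m) _ _ ⟩
  n % m + ((m ∸ n % m) + n / m * m)    ≡⟨ cong (_+_ (n % m)) (+-comm (m ∸ n % m) _) ⟩
  n % m + (n / m * m + (m ∸ n % m))    ≡⟨ sym (+-assoc (n % m) _ _) ⟩
  n % m + n / m * m + (m ∸ n % m)      ≡⟨ cong (_+ (m ∸ n % m)) (sym (m≡m%n+[m/n]*n n m)) ⟩
  n + (m ∸ n % m)                      ∎
  where open ≡-Reasoning

coprime⇒m∸n%m<m : ∀ {m n} .{{_ : NonZero m}} → Coprime m n → 1 < m → m ∸ n % m < m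
coprime⇒m∸n%m<m {m} {n} cop 1<m with n % m in n%m≡r
... | zero  = ⊥-elim (<-irrefl (sym (cop (∣-refl , m%n≡0⇒n∣m n m n%m≡r))) 1<m)
... | suc r = ∸-monoʳ-< (s≤s z≤n) (subst (_≤ m) n%m≡r (<⇒≤ (m%n<n n m)))

1+n*[1+n]≡[1+n]*[1+n]∸[1+n]+1 : ∀ n → suc (n * suc n) ≡ suc n * suc n ∸ suc n + 1
1+n*[1+n]≡[1+n]*[1+n]∸[1+n]+1 n = begin
  suc (n * suc n)                 ≡⟨ +-comm 1 (n * suc n) ⟩
  n * suc n + 1                   ≡⟨ cong (_+ 1) (sym (m+n∸m≡n (suc n) (n * suc n))) ⟩
  suc n * suc n ∸ suc n + 1       ∎
  where open ≡-Reasoning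

+[n+m]-+n≡+m : ∀ n m → + (n + m) ℤ.- + n ≡ + m
+[n+m]-+n≡+m n m = begin
  + (n + m) ℤ.- + n  ≡⟨ ℤ.m-n≡m⊖n (n + m) n ⟩
  (n + m) ℤ.⊖ n      ≡⟨ ℤ.⊖-≥ (m≤m+n n m) ⟩
  + (n + m ∸ n)      ≡⟨ cong +_ (m+n∸m≡n n m) ⟩
  + m                ∎
  where open ≡-Reasoning

i*+g≡+[1+m]⇒i≡+[1+k] : ∀ i g {m} → i ℤ.* + g ≡ +[1+ m ] → ∃ λ k → i ≡ +[1+ k ] × k ≤ m
i*+g≡+[1+m]⇒i≡+[1+k] (+ zero)   g       ()
i*+g≡+[1+m]⇒i≡+[1+k] +[1+ k ]   zero    eq rewrite ℤ.*-zeroʳ +[1+ k ] with eq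
... | ()
i*+g≡+[1+m]⇒i≡+[1+k] +[1+ k ]   (suc g) eq =
  k , refl , s≤s⁻¹ (subst (suc k ≤_) (ℤ.+-injective eq) (m≤m*n (suc k) (suc g)))
i*+g≡+[1+m]⇒i≡+[1+k] -[1+ k ]   zero    eq rewrite ℤ.*-zeroʳ -[1+ k ] with eq
... | ()
i*+g≡+[1+m]⇒i≡+[1+k] -[1+ k ]   (suc g) ()

↥-normalize-pos : ∀ m n .{{_ : NonZero m}} .{{_ : NonZero n}} →
  ∃ λ k → ↥ normalize m n ≡ +[1+ k ] × k < m
↥-normalize-pos (suc m) n = map₂ (map₂ s≤s) (i*+g≡+[1+m]⇒i≡+[1+k] _ _ (↥-normalize (suc m) n))

greedyNext : ℚ → ℚ
greedyNext r = r - unitFrac (greedyStep r)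

unitFrac-mkℚ : ∀ d → unitFrac (suc d) ≡ mkℚ +[1+ 0 ] d (1-coprimeTo (suc d))
unitFrac-mkℚ d = normalize-coprime (1-coprimeTo (suc d))

greedyStep-mkℚ : ∀ n d .(c : Coprime (suc n) (suc d)) →
  greedyStep (mkℚ +[1+ n ] d c) ≡ suc (suc d / suc n)
greedyStep-mkℚ n d c = cong (λ z → suc ℤ.∣ z ∣) (ℤ.*-identityˡ (+ (suc d / suc n)))

greedyStep-unitFrac : ∀ d → greedyStep (unitFrac (suc d)) ≡ suc (suc d)
greedyStep-unitFrac d = begin
  greedyStep (unitFrac (suc d))  ≡⟨ cong greedyStep (unitFrac-mkℚ d) ⟩
  greedyStep (mkℚ +[1+ 0 ] d c)  ≡⟨ greedyStep-mkℚ 0 d c ⟩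
  suc (suc d / 1)                ≡⟨ cong suc (n/1≡n (suc d)) ⟩
  suc (suc d)                    ∎
  where
  open ≡-Reasoning
  c : Coprime 1 (suc d)
  c = 1-coprimeTo (suc d)

greedyNext-mkℚ : ∀ n d .(c : Coprime (suc n) (suc d)) →
  greedyNext (mkℚ +[1+ n ] d c) ≡
    normalize (suc n ∸ suc d % suc n) (suc d * suc (suc d / suc n))
greedyNext-mkℚ n d c = begin
  r - unitFrac (greedyStep r)   ≡⟨ cong (λ x → r - unitFrac x) (greedyStep-mkℚ n d c) ⟩
  r - unitFrac (suc q)          ≡⟨ cong (r -_) (unitFrac-mkℚ q) ⟩
  r - mkℚ +[1+ 0 ] q (1-coprimeTo (suc q)) ≡⟨⟩
  (+ (a * suc q) ℤ.- + (1 * b)) /ℚ (b * suc q)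
    ≡⟨ cong (λ z → (+ (a * suc q) ℤ.- + z) /ℚ (b * suc q)) (*-identityˡ b) ⟩
  (+ (a * suc q) ℤ.- + b) /ℚ (b * suc q)
    ≡⟨ cong (λ z → (+ z ℤ.- + b) /ℚ (b * suc q)) (m*[1+n/m]≡n+[m∸n%m] a b) ⟩
  (+ (b + (a ∸ b % a)) ℤ.- + b) /ℚ (b * suc q)
    ≡⟨ cong (_/ℚ (b * suc q)) (+[n+m]-+n≡+m b (a ∸ b % a)) ⟩
  normalize (a ∸ b % a) (b * suc q) ∎
  where
  open ≡-Reasoning
  a = suc n
  b = suc d
  q = b / a
  r = mkℚ +[1+ n ] d c

greedyNext-unitFrac : ∀ d → greedyNext (unitFrac (suc d)) ≡ unitFrac (suc d * suc (suc d))
greedyNext-unitFrac d = begin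
  greedyNext (unitFrac (suc d))                          ≡⟨ cong greedyNext (unitFrac-mkℚ d) ⟩
  greedyNext (mkℚ +[1+ 0 ] d c)                          ≡⟨ greedyNext-mkℚ 0 d c ⟩
  normalize (1 ∸ suc d % 1) (suc d * suc (suc d / 1))
    ≡⟨ normalize-cong (cong (1 ∸_) (n%1≡0 (suc d))) (cong (λ z → suc d * suc z) (n/1≡n (suc d))) ⟩
  unitFrac (suc d * suc (suc d))                         ∎
  where
  open ≡-Reasoning
  c : Coprime 1 (suc d)
  c = 1-coprimeTo (suc d)

↥-greedyNext-< : ∀ {r n} → ↥ r ≡ +[1+ suc n ] → ∃ λ k → ↥ greedyNext r ≡ +[1+ k ] × k ≤ n
↥-greedyNext-< {mkℚ _ d c} {n} refl
  with ↥-normalize-pos (a ∸ b % a) (b * suc (b / a)) {{>-nonZero (m<n⇒0<n∸m (m%n<n b a))}}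
  where a = suc (suc n); b = suc d
... | k , ↥≡ , k<m = k , trans (cong ↥_ (greedyNext-mkℚ (suc n) d c)) ↥≡ ,
      s≤s⁻¹ (<-≤-trans k<m (s≤s⁻¹ (coprime⇒m∸n%m<m (recompute (coprime? _ _) c) (s≤s (s≤s z≤n)))))

IsUnitFrac : ℚ → Set
IsUnitFrac r = ∃ λ d → r ≡ unitFrac (suc d)

↥≡1⇒IsUnitFrac : ∀ {r} → ↥ r ≡ +[1+ 0 ] → IsUnitFrac r
↥≡1⇒IsUnitFrac {mkℚ _ d _} refl = d , sym (unitFrac-mkℚ d)

positive⇒↥≡+[1+n] : ∀ {r} → 0ℚ <ℚ r → ∃ λ n → ↥ r ≡ +[1+ n ]
positive⇒↥≡+[1+n] {mkℚ +[1+ n ]  _ _} _                  = n , refl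
positive⇒↥≡+[1+n] {mkℚ (+ zero)  _ _} (*<* (ℤ.+<+ ()))
positive⇒↥≡+[1+n] {mkℚ -[1+ _ ]  _ _} (*<* ())

module _ (λ' : ℚ) where

  greedyRem-unitFrac-suc : ∀ {i} → IsUnitFrac (greedyRem λ' i) → IsUnitFrac (greedyRem λ' (suc i))
  greedyRem-unitFrac-suc (d , Rᵢ≡) =
    suc d + d * suc (suc d) , trans (cong greedyNext Rᵢ≡) (greedyNext-unitFrac d)

  greedyRem-unitFrac-≤′ : ∀ {i j} → IsUnitFrac (greedyRem λ' i) → i ≤′ j → IsUnitFrac (greedyRem λ' j)
  greedyRem-unitFrac-≤′ u ≤′-refl = u
  greedyRem-unitFrac-≤′ {j = suc j} u (≤′-step i≤j) =
    greedyRem-unitFrac-suc {j} (greedyRem-unitFrac-≤′ u i≤j)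

  greedyRem-eventually-unitFrac : ∀ bound i {k} → k ≤ bound → ↥ greedyRem λ' i ≡ +[1+ k ] →
    ∃ λ N → IsUnitFrac (greedyRem λ' N)
  greedyRem-eventually-unitFrac _ i {zero} _ ↥Rᵢ≡ = i , ↥≡1⇒IsUnitFrac ↥Rᵢ≡
  greedyRem-eventually-unitFrac (suc bound) i {suc k} (s≤s k≤bound) ↥Rᵢ≡
    with ↥-greedyNext-< {greedyRem λ' i} ↥Rᵢ≡
  ... | k′ , ↥Rᵢ₊₁≡ , k′≤k = greedyRem-eventually-unitFrac bound (suc i) (≤-trans k′≤k k≤bound) ↥Rᵢ₊₁≡

  egyptian-sylvester : ∀ {i} → IsUnitFrac (greedyRem λ' i) →
    egyptian λ' (suc i) ≡ egyptian λ' i * egyptian λ' i ∸ egyptian λ' i + 1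
  egyptian-sylvester {i} (d , Rᵢ≡) = begin
    greedyStep (greedyNext (greedyRem λ' i))       ≡⟨ cong (λ r → greedyStep (greedyNext r)) Rᵢ≡ ⟩
    greedyStep (greedyNext (unitFrac (suc d)))     ≡⟨ cong greedyStep (greedyNext-unitFrac d) ⟩
    greedyStep (unitFrac (suc d * suc (suc d)))    ≡⟨ greedyStep-unitFrac (suc d + d * suc (suc d)) ⟩
    suc (suc d * suc (suc d))                      ≡⟨ 1+n*[1+n]≡[1+n]*[1+n]∸[1+n]+1 (suc d) ⟩
    suc (suc d) * suc (suc d) ∸ suc (suc d) + 1    ≡⟨ cong (λ x → x * x ∸ x + 1) (sym xᵢ≡) ⟩
    egyptian λ' i * egyptian λ' i ∸ egyptian λ' i + 1 ∎
    where
    open ≡-Reasoning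
    xᵢ≡ : egyptian λ' i ≡ suc (suc d)
    xᵢ≡ = trans (cong greedyStep Rᵢ≡) (greedyStep-unitFrac d)

corollary2p4 : (λ' : ℚ) → 0ℚ <ℚ λ' → λ' ≤ℚ 1ℚ →
    ∃ λ N → ∀ n → N ≤ n →
      egyptian λ' (suc n) ≡ egyptian λ' n * egyptian λ' n ∸ egyptian λ' n + 1
corollary2p4 λ' 0<λ' _ =
  N , λ n N≤n → egyptian-sylvester λ' {n} (greedyRem-unitFrac-≤′ λ' unitFrac-N (≤⇒≤′ N≤n))
  where
  numerator = positive⇒↥≡+[1+n] 0<λ'
  eventually = greedyRem-eventually-unitFrac λ' (proj₁ numerator) 0 ≤-refl (proj₂ numerator)
  N = proj₁ eventually
  unitFrac-N = proj₂ eventually
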